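{- For any $\mathcal{L}_{\tau\sim}$-formula $\alpha$, $\mathbf{KM}_\tau\vdash\alpha$ if and only if $\alpha$ is valid in every $\tau\sim$-expansion.
   Context: $\mathcal{L}_{\tau\sim}$ is the propositional language with variables, connectives $\wedge,\vee,\rightarrow,\neg$, a nullary connective $\tau$ and a unary connective $\sim$. $\mathbf{KM}_\tau$ has as axioms those of intuitionistic propositional logic (in $\mathcal{L}_{\tau\sim}$) plus $\sim p\leftrightarrow(p\rightarrow\tau)\wedge\sim\tau$, $(\sim\tau\rightarrow\tau)\rightarrow\tau$, $\sim\tau\rightarrow(p\vee(p\rightarrow\tau))$, $\tau\rightarrow\sim\tau$; rules: uniform substitution and modus ponens. A $\sim$-negation on a Heyting algebra is a unary operation $\sim$ satisfying for all $x,y$: $x\rightarrow y\le\sim y\rightarrow\sim x$; $x\wedge\sim x\le\sim\mathbf{1}$; $\sim\mathbf{0}\le x\vee\sim x$; $\sim\mathbf{0}\rightarrow\sim\mathbf{1}\le\sim\mathbf{1}$. A $\tau\sim$-expansion is a Heyting algebra with a constant $\tau$ and a $\sim$-negation with $\sim\mathbf{1}=\tau$. A formula is valid in an algebra if it takes value $\mathbf{1}$ under every valuation. -}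

module Defs where

open import Level using (Level; _⊔_) renaming (suc to lsuc)
open import Data.Nat using (ℕ)
open import Relation.Binary.Lattice.Bundles using (HeytingAlgebra)

infixr 4 _⇒_
infixr 5 _∨'_
infixr 6 _∧'_
infix 3 _⇔_
infix 8 ¬'_ ∼'_

data Fm : Set where
  var  : ℕ → Fm
  _∧'_ : Fm → Fm → Fm
  _∨'_ : Fm → Fm → Fm
  _⇒_  : Fm → Fm → Fm
  ¬'_  : Fm → Fm
  τ'   : Fm
  ∼'_  : Fm → Fm

_⇔_ : Fm → Fm → Fm
a ⇔ b = (a ⇒ b) ∧' (b ⇒ a)

subst : (ℕ → Fm) → Fm → Fm
subst σ (var n)  = σ n
subst σ (a ∧' b) = subst σ a ∧' subst σ b
subst σ (a ∨' b) = subst σ a ∨' subst σ b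
subst σ (a ⇒ b)  = subst σ a ⇒ subst σ b
subst σ (¬' a)   = ¬' subst σ a
subst σ τ'       = τ'
subst σ (∼' a)   = ∼' subst σ a

p q r : Fm
p = var 0
q = var 1
r = var 2

data Axiom : Fm → Set where
  ax-K    : Axiom (p ⇒ (q ⇒ p))
  ax-S    : Axiom ((p ⇒ (q ⇒ r)) ⇒ ((p ⇒ q) ⇒ (p ⇒ r)))
  ax-∧E₁  : Axiom ((p ∧' q) ⇒ p)
  ax-∧E₂  : Axiom ((p ∧' q) ⇒ q)
  ax-∧I   : Axiom (p ⇒ (q ⇒ (p ∧' q)))
  ax-∨I₁  : Axiom (p ⇒ (p ∨' q))
  ax-∨I₂  : Axiom (q ⇒ (p ∨' q))
  ax-∨E   : Axiom ((p ⇒ r) ⇒ ((q ⇒ r) ⇒ ((p ∨' q) ⇒ r)))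
  ax-¬I   : Axiom ((p ⇒ q) ⇒ ((p ⇒ ¬' q) ⇒ ¬' p))
  ax-¬E   : Axiom (¬' p ⇒ (p ⇒ q))
  ax-∼    : Axiom (∼' p ⇔ ((p ⇒ τ') ∧' ∼' τ'))
  ax-τ₁   : Axiom ((∼' τ' ⇒ τ') ⇒ τ')
  ax-τ₂   : Axiom (∼' τ' ⇒ (p ∨' (p ⇒ τ')))
  ax-τ₃   : Axiom (τ' ⇒ ∼' τ')

data KM⊢_ : Fm → Set where
  axiom : ∀ {a} → Axiom a → KM⊢ a
  usub  : ∀ {a} (σ : ℕ → Fm) → KM⊢ a → KM⊢ subst σ a
  mp    : ∀ {a b} → KM⊢ (a ⇒ b) → KM⊢ a → KM⊢ b

record TauExpansion (c ℓ₁ ℓ₂ : Level) : Set (lsuc (c ⊔ ℓ₁ ⊔ ℓ₂)) where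
  field
    heyting : HeytingAlgebra c ℓ₁ ℓ₂
  open HeytingAlgebra heyting public
  field
    τ  : Carrier
    ∼  : Carrier → Carrier
    ∼-contra : ∀ x y → (x ⇨ y) ≤ (∼ y ⇨ ∼ x)
    ∼-nc     : ∀ x → (x ∧ ∼ x) ≤ ∼ ⊤
    ∼-em     : ∀ x → ∼ ⊥ ≤ (x ∨ ∼ x)
    ∼-top    : (∼ ⊥ ⇨ ∼ ⊤) ≤ ∼ ⊤
    ∼⊤≈τ     : ∼ ⊤ ≈ τ

module _ {c ℓ₁ ℓ₂} (A : TauExpansion c ℓ₁ ℓ₂) where
  open TauExpansion A

  ⟦_⟧ : Fm → (ℕ → Carrier) → Carrier
  ⟦ var n ⟧  v = v n
  ⟦ a ∧' b ⟧ v = ⟦ a ⟧ v ∧ ⟦ b ⟧ v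
  ⟦ a ∨' b ⟧ v = ⟦ a ⟧ v ∨ ⟦ b ⟧ v
  ⟦ a ⇒ b ⟧  v = ⟦ a ⟧ v ⇨ ⟦ b ⟧ v
  ⟦ ¬' a ⟧   v = ⟦ a ⟧ v ⇨ ⊥
  ⟦ τ' ⟧     v = τ
  ⟦ ∼' a ⟧   v = ∼ (⟦ a ⟧ v)

  Valid : Fm → Set (c ⊔ ℓ₁)
  Valid a = ∀ (v : ℕ → Carrier) → ⟦ a ⟧ v ≈ ⊤

-- For ax-∼ the point is that a ∼-negation satisfies
-- ∼ x = (x → τ) ∧ ∼ τ: one half is ∼-nc, the other follows by cases on
-- x ∨ ∼ x (∼-em), using τ = ∼ 1 ≤ ∼ x. Completeness: formulas ordered by
-- provable implication form a τ∼-expansion (the Lindenbaum–Tarski algebra, as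
-- a setoid rather than a quotient), and under the valuation var n ↦ var n
-- every formula evaluates to a formula provably equivalent to itself.
module Submission where

open import Defs
open import Level using (Level; Lift; lift; lower)
open import Data.Product using (_×_; _,_; proj₁; proj₂)
open import Data.Nat using (ℕ; zero; suc)
open import Data.List using (List; []; _∷_; [_])
open import Data.List.Membership.Propositional using (_∈_)
open import Data.List.Relation.Unary.Any using (here; there)
open import Relation.Binary.PropositionalEquality as ≡ using (_≡_)
open import Relation.Binary.Structures using (IsPartialOrder)
open import Relation.Binary.Lattice.Structures using (IsHeytingAlgebra)
import Relation.Binary.Lattice.Properties.HeytingAlgebra as HeytingAlgebraProperties
import Relation.Binary.Lattice.Properties.JoinSemilattice as JoinSemilatticeProperties

private variable
  Γ : List Fm
  a a′ b b′ c : Fm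

sub₃ : Fm → Fm → Fm → ℕ → Fm
sub₃ a b c zero          = a
sub₃ a b c (suc zero)    = b
sub₃ a b c (suc (suc _)) = c

axiom-inst : ∀ {φ} → Axiom φ → ∀ a b c → KM⊢ subst (sub₃ a b c) φ
axiom-inst ax a b c = usub (sub₃ a b c) (axiom ax)

⇒-refl : ∀ a → KM⊢ (a ⇒ a)
⇒-refl a = mp (mp (axiom-inst ax-S a (a ⇒ a) a) (axiom-inst ax-K a (a ⇒ a) a))
              (axiom-inst ax-K a a a)

infix 2 _⊢_

data _⊢_ (Γ : List Fm) : Fm → Set where
  hyp : a ∈ Γ → Γ ⊢ a
  thm : KM⊢ a → Γ ⊢ a
  ⇒E  : Γ ⊢ a ⇒ b → Γ ⊢ a → Γ ⊢ b

⇒I : a ∷ Γ ⊢ b → Γ ⊢ a ⇒ b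
⇒I {a} (hyp (here ≡.refl))       = thm (⇒-refl a)
⇒I {a} {b = b} (hyp (there b∈Γ)) = ⇒E (thm (axiom-inst ax-K b a a)) (hyp b∈Γ)
⇒I {a} {b = b} (thm ⊢b)          = ⇒E (thm (axiom-inst ax-K b a a)) (thm ⊢b)
⇒I {a} {b = b} (⇒E {c} d e)      = ⇒E (⇒E (thm (axiom-inst ax-S a c b)) (⇒I d)) (⇒I e)

close : [] ⊢ a → KM⊢ a
close (hyp ())
close (thm ⊢a)  = ⊢a
close (⇒E d e) = mp (close d) (close e)

deduce : [ a ] ⊢ b → KM⊢ (a ⇒ b)
deduce d = close (⇒I d)

#0 : a ∷ Γ ⊢ a
#0 = hyp (here ≡.refl)

#1 : b ∷ a ∷ Γ ⊢ a
#1 = hyp (there (here ≡.refl))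

#2 : c ∷ b ∷ a ∷ Γ ⊢ a
#2 = hyp (there (there (here ≡.refl)))

via : KM⊢ (a ⇒ b) → Γ ⊢ a → Γ ⊢ b
via ⊢a⇒b d = ⇒E (thm ⊢a⇒b) d

∧I : Γ ⊢ a → Γ ⊢ b → Γ ⊢ a ∧' b
∧I {a = a} {b} d e = ⇒E (via (axiom-inst ax-∧I a b a) d) e

∧E₁ : Γ ⊢ a ∧' b → Γ ⊢ a
∧E₁ {a = a} {b} = via (axiom-inst ax-∧E₁ a b a)

∧E₂ : Γ ⊢ a ∧' b → Γ ⊢ b
∧E₂ {a = a} {b} = via (axiom-inst ax-∧E₂ a b a)

∨I₁ : Γ ⊢ a → Γ ⊢ a ∨' b
∨I₁ {a = a} {b} = via (axiom-inst ax-∨I₁ a b a)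

∨I₂ : Γ ⊢ b → Γ ⊢ a ∨' b
∨I₂ {b = b} {a} = via (axiom-inst ax-∨I₂ a b a)

∨E : Γ ⊢ a ∨' b → a ∷ Γ ⊢ c → b ∷ Γ ⊢ c → Γ ⊢ c
∨E {a = a} {b} {c} d e f = ⇒E (⇒E (via (axiom-inst ax-∨E a b c) (⇒I e)) (⇒I f)) d

¬I : Γ ⊢ a ⇒ b → Γ ⊢ a ⇒ ¬' b → Γ ⊢ ¬' a
¬I {a = a} {b} d e = ⇒E (via (axiom-inst ax-¬I a b a) d) e

¬E : Γ ⊢ ¬' a → Γ ⊢ a → Γ ⊢ b
¬E {a = a} {b = b} d e = ⇒E (via (axiom-inst ax-¬E a b a) d) e

∼E : Γ ⊢ ∼' a → Γ ⊢ (a ⇒ τ') ∧' ∼' τ'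
∼E {a = a} = via (close (∧E₁ (thm (axiom-inst ax-∼ a a a))))

∼I : Γ ⊢ (a ⇒ τ') ∧' ∼' τ' → Γ ⊢ ∼' a
∼I {a = a} = via (close (∧E₂ (thm (axiom-inst ax-∼ a a a))))

τI : Γ ⊢ ∼' τ' ⇒ τ' → Γ ⊢ τ'
τI = via (axiom-inst ax-τ₁ τ' τ' τ')

τ-em : ∀ a → Γ ⊢ ∼' τ' → Γ ⊢ a ∨' (a ⇒ τ')
τ-em a = via (axiom-inst ax-τ₂ a a a)

τ⇒∼τ : Γ ⊢ τ' → Γ ⊢ ∼' τ'
τ⇒∼τ = via (axiom-inst ax-τ₃ τ' τ' τ')

⊤F ⊥F : Fm
⊤F = p ⇒ p
⊥F = ¬' ⊤F

⊤I : Γ ⊢ ⊤F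
⊤I = thm (⇒-refl p)

infix 3 _⊣⊢_

_⊣⊢_ : Fm → Fm → Set
a ⊣⊢ b = KM⊢ (a ⇒ b) × KM⊢ (b ⇒ a)

⇒-trans : KM⊢ (a ⇒ b) → KM⊢ (b ⇒ c) → KM⊢ (a ⇒ c)
⇒-trans ⊢a⇒b ⊢b⇒c = deduce (via ⊢b⇒c (via ⊢a⇒b #0))

⊣⊢-refl : a ⊣⊢ a
⊣⊢-refl = ⇒-refl _ , ⇒-refl _

⊣⊢-sym : a ⊣⊢ b → b ⊣⊢ a
⊣⊢-sym (f , g) = g , f

⊣⊢-trans : a ⊣⊢ b → b ⊣⊢ c → a ⊣⊢ c
⊣⊢-trans (f , g) (f′ , g′) = ⇒-trans f f′ , ⇒-trans g′ g

∼-contravariant : KM⊢ ((a ⇒ b) ⇒ (∼' b ⇒ ∼' a))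
∼-contravariant = close (⇒I (⇒I (∼I (∧I (⇒I (⇒E (∧E₁ (∼E #1)) (⇒E #2 #0))) (∧E₂ (∼E #0))))))

∧'-cong : a ⊣⊢ a′ → b ⊣⊢ b′ → a ∧' b ⊣⊢ a′ ∧' b′
∧'-cong (f , g) (f′ , g′) = deduce (∧I (via f (∧E₁ #0)) (via f′ (∧E₂ #0)))
                          , deduce (∧I (via g (∧E₁ #0)) (via g′ (∧E₂ #0)))

∨'-cong : a ⊣⊢ a′ → b ⊣⊢ b′ → a ∨' b ⊣⊢ a′ ∨' b′
∨'-cong (f , g) (f′ , g′) = deduce (∨E #0 (∨I₁ (via f #0)) (∨I₂ (via f′ #0)))
                          , deduce (∨E #0 (∨I₁ (via g #0)) (∨I₂ (via g′ #0)))

⇒-cong : a ⊣⊢ a′ → b ⊣⊢ b′ → (a ⇒ b) ⊣⊢ (a′ ⇒ b′)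
⇒-cong (f , g) (f′ , g′) = deduce (⇒I (via f′ (⇒E #1 (via g #0))))
                         , deduce (⇒I (via g′ (⇒E #1 (via f #0))))

∼'-cong : a ⊣⊢ b → ∼' a ⊣⊢ ∼' b
∼'-cong (f , g) = mp ∼-contravariant g , mp ∼-contravariant f

⇒⊥F⊣⊢¬ : (a ⇒ ⊥F) ⊣⊢ ¬' a
⇒⊥F⊣⊢¬ = deduce (¬I (⇒I ⊤I) (⇒I (⇒E #1 #0))) , deduce (⇒I (¬E #1 #0))

∼⊤F⊣⊢τ : ∼' ⊤F ⊣⊢ τ'
∼⊤F⊣⊢τ = deduce (⇒E (∧E₁ (∼E #0)) ⊤I) , deduce (∼I (∧I (⇒I #1) (τ⇒∼τ #0)))

∼⊥F⊣⊢∼τ : ∼' ⊥F ⊣⊢ ∼' τ'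
∼⊥F⊣⊢∼τ = deduce (∧E₂ (∼E #0)) , deduce (∼I (∧I (⇒I (¬E #0 ⊤I)) #0))

module Soundness {c ℓ₁ ℓ₂} (A : TauExpansion c ℓ₁ ℓ₂) where
  open TauExpansion A
  open HeytingAlgebraProperties heyting using (swap-transpose-⇨; ⇨-relax)
  open JoinSemilatticeProperties joinSemilattice using (∨-monotonic)

  private variable w x y z : Carrier

  -- An entailment w ≤ x is read as a sequent whose hypotheses are conjoined
  -- in w, the most recent one rightmost; with these rules an axiom is
  -- validated by transcribing its natural-deduction proof.
  hyp₀ : w ∧ x ≤ x
  hyp₀ = x∧y≤y _ _

  weaken : w ≤ x → w ∧ y ≤ x
  weaken w≤x = trans (x∧y≤x _ _) w≤x

  ⇨-intro : w ∧ x ≤ y → w ≤ x ⇨ y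
  ⇨-intro = transpose-⇨

  ⇨-elim : w ≤ x ⇨ y → w ≤ x → w ≤ y
  ⇨-elim w≤x⇨y w≤x = trans (∧-greatest refl w≤x) (transpose-∧ w≤x⇨y)

  ∧-elimˡ : w ≤ x ∧ y → w ≤ x
  ∧-elimˡ w≤x∧y = trans w≤x∧y (x∧y≤x _ _)

  ∧-elimʳ : w ≤ x ∧ y → w ≤ y
  ∧-elimʳ w≤x∧y = trans w≤x∧y (x∧y≤y _ _)

  ∨-introˡ : w ≤ x → w ≤ x ∨ y
  ∨-introˡ w≤x = trans w≤x (x≤x∨y _ _)

  ∨-introʳ : w ≤ y → w ≤ x ∨ y
  ∨-introʳ w≤y = trans w≤y (y≤x∨y _ _)

  ∨-elim : w ≤ x ∨ y → w ∧ x ≤ z → w ∧ y ≤ z → w ≤ z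
  ∨-elim w≤x∨y w∧x≤z w∧y≤z =
    ⇨-elim (trans w≤x∨y (∨-least (swap-transpose-⇨ w∧x≤z) (swap-transpose-⇨ w∧y≤z))) refl

  ⊥-elim : w ≤ ⊥ → w ≤ x
  ⊥-elim w≤⊥ = trans w≤⊥ (minimum _)

  x≤y⇒w≤x⇨y : x ≤ y → w ≤ x ⇨ y
  x≤y⇒w≤x⇨y x≤y = ⇨-intro (trans hyp₀ x≤y)

  ∼-antitone : x ≤ y → ∼ y ≤ ∼ x
  ∼-antitone x≤y = ⇨-elim (trans (x≤y⇒w≤x⇨y x≤y) (∼-contra _ _)) refl

  τ≤∼ : τ ≤ ∼ x
  τ≤∼ = trans (reflexive (Eq.sym ∼⊤≈τ)) (∼-antitone (maximum _))

  ∼≤∼⊥ : ∼ x ≤ ∼ ⊥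
  ∼≤∼⊥ = ∼-antitone (minimum _)

  ∼≤⇨τ : ∼ x ≤ x ⇨ τ
  ∼≤⇨τ = ⇨-intro (trans (∧-greatest hyp₀ (x∧y≤x _ _)) (trans (∼-nc _) (reflexive ∼⊤≈τ)))

  ⇨τ∧∼⊥≤∼ : (x ⇨ τ) ∧ ∼ ⊥ ≤ ∼ x
  ⇨τ∧∼⊥≤∼ = ∨-elim (trans (x∧y≤y _ _) (∼-em _))
                   (trans (⇨-elim (weaken (x∧y≤x _ _)) hyp₀) τ≤∼)
                   hyp₀

  ∼⊥≤∼τ : ∼ ⊥ ≤ ∼ τ
  ∼⊥≤∼τ = trans (∧-greatest (x≤y⇒w≤x⇨y refl) refl) ⇨τ∧∼⊥≤∼

  ∼≤⇨τ∧∼τ : ∼ x ≤ (x ⇨ τ) ∧ ∼ τ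
  ∼≤⇨τ∧∼τ = ∧-greatest ∼≤⇨τ (trans ∼≤∼⊥ ∼⊥≤∼τ)

  ⇨τ∧∼τ≤∼ : (x ⇨ τ) ∧ ∼ τ ≤ ∼ x
  ⇨τ∧∼τ≤∼ = trans (∧-greatest (x∧y≤x _ _) (trans (x∧y≤y _ _) ∼≤∼⊥)) ⇨τ∧∼⊥≤∼

  ∼τ⇨τ≤τ : ∼ τ ⇨ τ ≤ τ
  ∼τ⇨τ≤τ = trans (⇨-relax ∼⊥≤∼τ τ≤∼) (trans ∼-top (reflexive ∼⊤≈τ))

  ∼τ≤x∨x⇨τ : ∼ τ ≤ x ∨ (x ⇨ τ)
  ∼τ≤x∨x⇨τ = trans ∼≤∼⊥ (trans (∼-em _) (∨-monotonic refl ∼≤⇨τ))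

  ⟦_⟧ₐ : Fm → (ℕ → Carrier) → Carrier
  ⟦_⟧ₐ = ⟦_⟧ A

  axiom-valid : ∀ {φ} → Axiom φ → ∀ v → ⊤ ≤ ⟦ φ ⟧ₐ v
  axiom-valid ax-K   v = ⇨-intro (⇨-intro (weaken hyp₀))
  axiom-valid ax-S   v = ⇨-intro (⇨-intro (⇨-intro
    (⇨-elim (⇨-elim (weaken (weaken hyp₀)) hyp₀) (⇨-elim (weaken hyp₀) hyp₀))))
  axiom-valid ax-∧E₁ v = ⇨-intro (∧-elimˡ hyp₀)
  axiom-valid ax-∧E₂ v = ⇨-intro (∧-elimʳ hyp₀)
  axiom-valid ax-∧I  v = ⇨-intro (⇨-intro (∧-greatest (weaken hyp₀) hyp₀))
  axiom-valid ax-∨I₁ v = ⇨-intro (∨-introˡ hyp₀)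
  axiom-valid ax-∨I₂ v = ⇨-intro (∨-introʳ hyp₀)
  axiom-valid ax-∨E  v = ⇨-intro (⇨-intro (⇨-intro
    (∨-elim hyp₀ (⇨-elim (weaken (weaken (weaken hyp₀))) hyp₀) (⇨-elim (weaken (weaken hyp₀)) hyp₀))))
  axiom-valid ax-¬I  v = ⇨-intro (⇨-intro (⇨-intro
    (⇨-elim (⇨-elim (weaken hyp₀) hyp₀) (⇨-elim (weaken (weaken hyp₀)) hyp₀))))
  axiom-valid ax-¬E  v = ⇨-intro (⇨-intro (⊥-elim (⇨-elim (weaken hyp₀) hyp₀)))
  axiom-valid ax-∼   v = ∧-greatest (x≤y⇒w≤x⇨y ∼≤⇨τ∧∼τ) (x≤y⇒w≤x⇨y ⇨τ∧∼τ≤∼)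
  axiom-valid ax-τ₁  v = x≤y⇒w≤x⇨y ∼τ⇨τ≤τ
  axiom-valid ax-τ₂  v = x≤y⇒w≤x⇨y ∼τ≤x∨x⇨τ
  axiom-valid ax-τ₃  v = x≤y⇒w≤x⇨y τ≤∼

  ⟦⟧-subst : ∀ σ a v → ⟦ subst σ a ⟧ₐ v ≡ ⟦ a ⟧ₐ (λ n → ⟦ σ n ⟧ₐ v)
  ⟦⟧-subst σ (var n)  v = ≡.refl
  ⟦⟧-subst σ (a ∧' b) v = ≡.cong₂ _∧_ (⟦⟧-subst σ a v) (⟦⟧-subst σ b v)
  ⟦⟧-subst σ (a ∨' b) v = ≡.cong₂ _∨_ (⟦⟧-subst σ a v) (⟦⟧-subst σ b v)
  ⟦⟧-subst σ (a ⇒ b)  v = ≡.cong₂ _⇨_ (⟦⟧-subst σ a v) (⟦⟧-subst σ b v)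
  ⟦⟧-subst σ (¬' a)   v = ≡.cong (_⇨ ⊥) (⟦⟧-subst σ a v)
  ⟦⟧-subst σ τ'       v = ≡.refl
  ⟦⟧-subst σ (∼' a)   v = ≡.cong ∼ (⟦⟧-subst σ a v)

  ⊤≤⟦⟧ : KM⊢ a → ∀ v → ⊤ ≤ ⟦ a ⟧ₐ v
  ⊤≤⟦⟧ (axiom ax)       v = axiom-valid ax v
  ⊤≤⟦⟧ (usub {a} σ ⊢a)  v = ≡.subst (⊤ ≤_) (≡.sym (⟦⟧-subst σ a v)) (⊤≤⟦⟧ ⊢a _)
  ⊤≤⟦⟧ (mp ⊢a⇒b ⊢a)     v = ⇨-elim (⊤≤⟦⟧ ⊢a⇒b v) (⊤≤⟦⟧ ⊢a v)

  sound : KM⊢ a → Valid A a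
  sound ⊢a v = antisym (maximum _) (⊤≤⟦⟧ ⊢a v)

module Lindenbaum (c ℓ₁ ℓ₂ : Level) where
  Formula : Set c
  Formula = Lift c Fm

  _≈_ : Formula → Formula → Set ℓ₁
  x ≈ y = Lift ℓ₁ (lower x ⊣⊢ lower y)

  _≤_ : Formula → Formula → Set ℓ₂
  x ≤ y = Lift ℓ₂ (KM⊢ (lower x ⇒ lower y))

  lift₂ : (Fm → Fm → Fm) → Formula → Formula → Formula
  lift₂ _∙_ x y = lift (lower x ∙ lower y)

  isPartialOrder : IsPartialOrder _≈_ _≤_
  isPartialOrder = record
    { isPreorder = record
      { isEquivalence = record
        { refl  = lift ⊣⊢-refl
        ; sym   = λ x≈y → lift (⊣⊢-sym (lower x≈y))
        ; trans = λ x≈y y≈z → lift (⊣⊢-trans (lower x≈y) (lower y≈z))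
        }
      ; reflexive = λ x≈y → lift (proj₁ (lower x≈y))
      ; trans     = λ x≤y y≤z → lift (⇒-trans (lower x≤y) (lower y≤z))
      }
    ; antisym = λ x≤y y≤x → lift (lower x≤y , lower y≤x)
    }

  isHeytingAlgebra : IsHeytingAlgebra _≈_ _≤_ (lift₂ _∨'_) (lift₂ _∧'_) (lift₂ _⇒_)
                                      (lift ⊤F) (lift ⊥F)
  isHeytingAlgebra = record
    { isBoundedLattice = record
      { isLattice = record
        { isPartialOrder = isPartialOrder
        ; supremum = λ _ _ → lift (deduce (∨I₁ #0)) , lift (deduce (∨I₂ #0)) ,
            λ _ x≤z y≤z → lift (deduce (∨E #0 (via (lower x≤z) #0) (via (lower y≤z) #0)))
        ; infimum = λ _ _ → lift (deduce (∧E₁ #0)) , lift (deduce (∧E₂ #0)) ,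
            λ _ z≤x z≤y → lift (deduce (∧I (via (lower z≤x) #0) (via (lower z≤y) #0)))
        }
      ; maximum = λ _ → lift (deduce ⊤I)
      ; minimum = λ _ → lift (deduce (¬E #0 ⊤I))
      }
    ; exponential = λ _ _ _ →
        (λ w∧x≤y → lift (deduce (⇒I (via (lower w∧x≤y) (∧I #1 #0))))) ,
        (λ w≤x⇒y → lift (deduce (⇒E (via (lower w≤x⇒y) (∧E₁ #0)) (∧E₂ #0))))
    }

  lindenbaum : TauExpansion c ℓ₁ ℓ₂
  lindenbaum = record
    { heyting  = record { isHeytingAlgebra = isHeytingAlgebra }
    ; τ        = lift τ'
    ; ∼        = λ x → lift (∼' lower x)
    ; ∼-contra = λ _ _ → lift ∼-contravariant
    ; ∼-nc     = λ _ → lift (deduce (via (proj₂ ∼⊤F⊣⊢τ) (⇒E (∧E₁ (∼E (∧E₂ #0))) (∧E₁ #0))))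
    ; ∼-em     = λ x → lift (deduce (∨E (τ-em (lower x) (via (proj₁ ∼⊥F⊣⊢∼τ) #0))
                            (∨I₁ #0) (∨I₂ (∼I (∧I #0 (via (proj₁ ∼⊥F⊣⊢∼τ) #1))))))
    ; ∼-top    = lift (deduce (via (proj₂ ∼⊤F⊣⊢τ)
                   (τI (⇒I (via (proj₁ ∼⊤F⊣⊢τ) (⇒E #1 (via (proj₂ ∼⊥F⊣⊢∼τ) #0)))))))
    ; ∼⊤≈τ     = lift ∼⊤F⊣⊢τ
    }

  generic : ℕ → Formula
  generic n = lift (var n)

  ⟦_⟧ᵍ : Fm → Fm
  ⟦ α ⟧ᵍ = lower (⟦_⟧ lindenbaum α generic)

  ⟦⟧ᵍ⊣⊢ : ∀ α → ⟦ α ⟧ᵍ ⊣⊢ α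
  ⟦⟧ᵍ⊣⊢ (var n)  = ⊣⊢-refl
  ⟦⟧ᵍ⊣⊢ (a ∧' b) = ∧'-cong (⟦⟧ᵍ⊣⊢ a) (⟦⟧ᵍ⊣⊢ b)
  ⟦⟧ᵍ⊣⊢ (a ∨' b) = ∨'-cong (⟦⟧ᵍ⊣⊢ a) (⟦⟧ᵍ⊣⊢ b)
  ⟦⟧ᵍ⊣⊢ (a ⇒ b)  = ⇒-cong (⟦⟧ᵍ⊣⊢ a) (⟦⟧ᵍ⊣⊢ b)
  ⟦⟧ᵍ⊣⊢ (¬' a)   = ⊣⊢-trans (⇒-cong (⟦⟧ᵍ⊣⊢ a) ⊣⊢-refl) ⇒⊥F⊣⊢¬
  ⟦⟧ᵍ⊣⊢ τ'       = ⊣⊢-refl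
  ⟦⟧ᵍ⊣⊢ (∼' a)   = ∼'-cong (⟦⟧ᵍ⊣⊢ a)

  complete : ∀ α → Valid lindenbaum α → KM⊢ α
  complete α valid = mp (proj₁ (⟦⟧ᵍ⊣⊢ α)) (mp (proj₂ (lower (valid generic))) (⇒-refl p))

propositionP : ∀ (c ℓ₁ ℓ₂ : Level) (α : Fm) →
    (KM⊢ α → ∀ (A : TauExpansion c ℓ₁ ℓ₂) → Valid A α) ×
    ((∀ (A : TauExpansion c ℓ₁ ℓ₂) → Valid A α) → KM⊢ α)
propositionP c ℓ₁ ℓ₂ α =
  (λ ⊢α A → Soundness.sound A ⊢α) ,
  (λ valid → Lindenbaum.complete c ℓ₁ ℓ₂ α (valid (Lindenbaum.lindenbaum c ℓ₁ ℓ₂)))
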